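{- Let $w\in S_{\mathbb{Z}}$. Then: (a) for every reduced word $\boldsymbol{w}$ of $w$, if $j$ is an entry of $\mathrm{IncSuf}(\boldsymbol{w})$ then $\theta_j(w)=1$; (b) for every $i\in\mathbb{Z}$, $I_i(w)\le\lambda_i(w)$; (c) for every $i\in\mathbb{Z}$, if $\theta_i(w)=0$ then $I_{i-1}(w)=I_i(w)=\lambda_i(w)$.
   Context: $S_{\mathbb{Z}}$: bijections of $\mathbb{Z}$ fixing all but finitely many integers; $s_i=(i\ i{+}1)$; reduced words of $w$ are $(w_1,\dots,w_k)$ with $w=s_{w_1}\cdots s_{w_k}$, $k$ minimal. $\theta_j(w)=1$ if some $j'>j$ has $w(j')<w(j)$, else $0$; $\lambda_i(w)=\sum_{j\le i}\theta_j(w)$. For a word $p=(p_1,\dots,p_k)$, $\mathrm{IncSuf}(p)$ is its longest strictly increasing suffix, $I(p)$ its length, and $I_i(p)=I(p)$ if $k\ge1$ and $p_k\le i$, $I_i(p)=0$ otherwise. $I_i(w)$ is the maximum of $I_i(\boldsymbol{w})$ over all reduced words $\boldsymbol{w}$ of $w$. -}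

module Defs where

open import Data.Nat using (ℕ; zero; suc) renaming (_≤_ to _≤ℕ_; _<_ to _<ℕ_)
open import Data.Integer using (ℤ; _+_; _-_; _<_; _≤_; _<?_; _≤?_; ∣_∣; 1ℤ)
import Data.Integer.Properties as ℤP
open import Data.List using (List; []; _∷_; length; reverse)
open import Data.List.Membership.Propositional using (_∈_)
open import Data.List.Relation.Unary.Unique.Propositional using (Unique)
open import Data.Product using (Σ; _×_; _,_)
open import Relation.Binary.PropositionalEquality using (_≡_)
open import Relation.Nullary using (yes; no)
open import Function.Bundles using (_⇔_)

record SZ : Set where
  field
    fun     : ℤ → ℤ
    inv     : ℤ → ℤ
    inv-l   : ∀ x → inv (fun x) ≡ x
    inv-r   : ∀ x → fun (inv x) ≡ x
    finSupp : Σ ℕ (λ N → ∀ j → N <ℕ ∣ j ∣ → fun j ≡ j)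
open SZ public

s : ℤ → ℤ → ℤ
s a x with x ℤP.≟ a
... | yes _ = a + 1ℤ
... | no _ with x ℤP.≟ (a + 1ℤ)
... | yes _ = a
... | no _ = x

evalWord : List ℤ → ℤ → ℤ
evalWord [] x = x
evalWord (a ∷ p) x = s a (evalWord p x)

IsWord : SZ → List ℤ → Set
IsWord w p = ∀ x → evalWord p x ≡ fun w x

IsReducedWord : SZ → List ℤ → Set
IsReducedWord w p = IsWord w p × (∀ q → IsWord w q → length p ≤ℕ length q)

-- θ_j(w) = 1  (i.e. some j' > j has w(j') < w(j)); θ_j(w) = 0 is its negation
θ-one : SZ → ℤ → Set
θ-one w j = Σ ℤ (λ j' → j < j' × fun w j' < fun w j)

LambdaIs : SZ → ℤ → ℕ → Set
LambdaIs w i n = Σ (List ℤ) (λ L →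
  Unique L × (∀ j → (j ∈ L) ⇔ (j ≤ i × θ-one w j)) × length L ≡ n)

dp : ℤ → List ℤ → List ℤ
dp x [] = x ∷ []
dp x (y ∷ r) with y <? x
... | yes _ = x ∷ dp y r
... | no _ = x ∷ []

decPrefix : List ℤ → List ℤ
decPrefix [] = []
decPrefix (x ∷ r) = dp x r

IncSuf : List ℤ → List ℤ
IncSuf p = reverse (decPrefix (reverse p))

Ilen : List ℤ → ℕ
Ilen p = length (IncSuf p)

Iw : ℤ → List ℤ → ℕ
Iw i p with reverse p
... | [] = 0
... | (x ∷ _) with x ≤? i
...   | yes _ = Ilen p
...   | no _ = 0

IMaxIs : SZ → ℤ → ℕ → Set
IMaxIs w i m = Σ (List ℤ) (λ p → IsReducedWord w p × Iw i p ≡ m)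
             × (∀ p → IsReducedWord w p → Iw i p ≤ℕ m)

{-# OPTIONS --safe #-}

-- For a permutation f of ℤ moving only points of [-M, M], the number of
-- inversions inside that window is the length of f: composing with s a on the
-- right lowers it by one when a is a descent (f (a + 1) < f a) and raises it by
-- one otherwise, and removing descents one at a time sorts f.  Hence the last
-- letter a of a reduced word is a descent of the permutation it spells.
--
-- (a) If j lies in the increasing suffix of a reduced word u j v of w, all
-- letters of v exceed j, so v fixes j and sends some j′ > j to j + 1, while j is
-- a descent of u j; thus w j′ < w j.
-- (b) The increasing suffix consists of distinct letters, none above the last
-- letter, and by (a) each has θ = 1.
-- (c) If θ_i(w) = 0, the largest a ≤ i with θ_a(w) = 1 satisfies a < i and is a
-- descent of w; every j < a with θ_j(w) = 1 keeps θ_j = 1 for w s_a, whereas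
-- θ_a(w s_a) = 0.  Recursively w s_a has a reduced word whose increasing suffix
-- ends below a and contains all these j; appending a gives a reduced word of w
-- whose increasing suffix contains every j ≤ i with θ_j(w) = 1 and ends at
-- a ≤ i - 1.  So I_{i-1}(w) ≥ λ_i(w), and (b) gives the reverse inequalities.

module Submission where

open import Defs
open import Data.Empty using (⊥-elim)
open import Data.Integer
  using (ℤ; +_; -[1+_]; _+_; _-_; -_; _<_; _≤_; _<?_; _≤?_; ∣_∣; 1ℤ; +≤+; -≤+; -≤-; +<+; -<+; -<-)
import Data.Integer.Properties as ℤP
open import Data.Integer.Tactic.RingSolver using (solve-∀)
open import Data.List using (List; []; _∷_; length; reverse; _++_; _∷ʳ_; filter)
open import Data.List.Extrema ℤP.≤-totalOrder using (max; ⊥≤max; xs≤max; argmax-all)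
open import Data.List.Membership.Propositional using (_∈_; find; lose)
import Data.List.Membership.Propositional.Properties as ∈P
import Data.List.Properties as LP
open import Data.List.Relation.Binary.Permutation.Propositional using (↭-sym; ↭⇒↭ₛ)
open import Data.List.Relation.Binary.Permutation.Propositional.Properties using (↭-reverse)
import Data.List.Relation.Binary.Permutation.Setoid.Properties as ↭ₛ-Properties
open import Data.List.Relation.Unary.All as All using (All; []; _∷_)
open import Data.List.Relation.Unary.AllPairs using ([]; _∷_)
open import Data.List.Relation.Unary.Any using (here; there; any?)
import Data.List.Relation.Unary.Any.Properties as AnyP
open import Data.List.Relation.Unary.Unique.Propositional using (Unique)
import Data.List.Relation.Unary.Unique.Propositional.Properties as UniqueP
open import Data.List.Reverse using (reverseView; []; _∶_∶ʳ_)
open import Data.Nat using (ℕ; zero; suc; z≤n; s≤s; _≤′_; ≤′-refl; ≤′-step)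
  renaming (_≤_ to _≤ℕ_; _<_ to _<ℕ_; _+_ to _+ℕ_; _*_ to _*ℕ_)
import Data.Nat.Properties as ℕP
import Data.Nat.Tactic.RingSolver as ℕSolver
open import Data.Product using (Σ; _×_; _,_; proj₁; proj₂; uncurry)
open import Data.Sum using (_⊎_; inj₁; inj₂)
open import Function using (_∘_; case_of_)
open import Function.Bundles using (mk⇔)
open import Relation.Binary.Definitions using (DecidableEquality; tri<; tri≈; tri>)
open import Relation.Binary.PropositionalEquality
  using (_≡_; _≢_; refl; sym; trans; cong; cong₂; subst; subst₂; setoid; module ≡-Reasoning)
open import Relation.Nullary using (¬_; Dec; yes; no)
open import Relation.Nullary.Decidable using (_×-dec_)

i<i+1 : ∀ i → i < i + 1ℤ
i<i+1 i = subst (i <_) (ℤP.+-comm 1ℤ i) (ℤP.suc[i]≤j⇒i<j ℤP.≤-refl)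

i≢i+1 : ∀ i → i ≢ i + 1ℤ
i≢i+1 i = ℤP.<⇒≢ (i<i+1 i)

i<j⇒i+1≤j : ∀ {i j} → i < j → i + 1ℤ ≤ j
i<j⇒i+1≤j {i} i<j = subst (_≤ _) (ℤP.+-comm 1ℤ i) (ℤP.i<j⇒suc[i]≤j i<j)

i<j+1⇒i≤j : ∀ {i j} → i < j + 1ℤ → i ≤ j
i<j+1⇒i≤j {i} {j} i<j+1 = subst (i ≤_) (pred[j+1]≡j j) (ℤP.i<j⇒i≤pred[j] i<j+1)
  where
  pred[j+1]≡j : ∀ j → - 1ℤ + (j + 1ℤ) ≡ j
  pred[j+1]≡j = solve-∀

i<j⇒i≤j-1 : ∀ {i j} → i < j → i ≤ j - 1ℤ
i<j⇒i≤j-1 {i} {j} i<j = subst (i ≤_) (ℤP.+-comm (- 1ℤ) j) (ℤP.i<j⇒i≤pred[j] i<j)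

i≤j-1⇒i<j : ∀ {i j} → i ≤ j - 1ℤ → i < j
i≤j-1⇒i<j {i} {j} i≤j-1 = ℤP.i≤pred[j]⇒i<j (subst (i ≤_) (ℤP.+-comm j (- 1ℤ)) i≤j-1)

-- Transpositions and words

s-a : ∀ a → s a a ≡ a + 1ℤ
s-a a with a ℤP.≟ a
... | yes _ = refl
... | no a≢a = ⊥-elim (a≢a refl)

s-a+1 : ∀ a → s a (a + 1ℤ) ≡ a
s-a+1 a with (a + 1ℤ) ℤP.≟ a
... | yes a+1≡a = ⊥-elim (i≢i+1 a (sym a+1≡a))
... | no _ with (a + 1ℤ) ℤP.≟ (a + 1ℤ)
...   | yes _ = refl
...   | no a+1≢a+1 = ⊥-elim (a+1≢a+1 refl)

s-fix : ∀ a {x} → x ≢ a → x ≢ a + 1ℤ → s a x ≡ x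
s-fix a {x} x≢a x≢a+1 with x ℤP.≟ a
... | yes x≡a = ⊥-elim (x≢a x≡a)
... | no _ with x ℤP.≟ (a + 1ℤ)
...   | yes x≡a+1 = ⊥-elim (x≢a+1 x≡a+1)
...   | no _ = refl

data Position (a : ℤ) : ℤ → Set where
  left  : Position a a
  right : Position a (a + 1ℤ)
  away  : ∀ {x} → x ≢ a → x ≢ a + 1ℤ → Position a x

position : ∀ a x → Position a x
position a x with x ℤP.≟ a
... | yes refl = left
... | no x≢a with x ℤP.≟ (a + 1ℤ)
...   | yes refl = right
...   | no x≢a+1 = away x≢a x≢a+1

s-involutive : ∀ a x → s a (s a x) ≡ x
s-involutive a x with position a x
... | left = trans (cong (s a) (s-a a)) (s-a+1 a)
... | right = trans (cong (s a) (s-a+1 a)) (s-a a)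
... | away x≢a x≢a+1 = trans (cong (s a) (s-fix a x≢a x≢a+1)) (s-fix a x≢a x≢a+1)

s-fix-< : ∀ {a x} → x < a → s a x ≡ x
s-fix-< {a} x<a = s-fix a (ℤP.<⇒≢ x<a) (ℤP.<⇒≢ (ℤP.<-trans x<a (i<i+1 a)))

s-preserves-> : ∀ {a j x} → j < a → j < x → j < s a x
s-preserves-> {a} {j} {x} j<a j<x with position a x
... | left = subst (j <_) (sym (s-a a)) (ℤP.<-trans j<a (i<i+1 a))
... | right = subst (j <_) (sym (s-a+1 a)) j<a
... | away x≢a x≢a+1 = subst (j <_) (sym (s-fix a x≢a x≢a+1)) j<x

s-preserves-< : ∀ a {x y} → x < y → ¬ (x ≡ a × y ≡ a + 1ℤ) → s a x < s a y
s-preserves-< a {x} {y} x<y not-swapped with position a x | position a y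
... | left  | left  = ⊥-elim (ℤP.<-irrefl refl x<y)
... | left  | right = ⊥-elim (not-swapped (refl , refl))
... | left  | away y≢a y≢a+1 =
  subst₂ _<_ (sym (s-a a)) (sym (s-fix a y≢a y≢a+1)) (ℤP.≤∧≢⇒< (i<j⇒i+1≤j x<y) (y≢a+1 ∘ sym))
... | right | left  = ⊥-elim (ℤP.<-asym x<y (i<i+1 a))
... | right | right = ⊥-elim (ℤP.<-irrefl refl x<y)
... | right | away y≢a y≢a+1 =
  subst₂ _<_ (sym (s-a+1 a)) (sym (s-fix a y≢a y≢a+1)) (ℤP.<-trans (i<i+1 a) x<y)
... | away x≢a x≢a+1 | left =
  subst₂ _<_ (sym (s-fix a x≢a x≢a+1)) (sym (s-a a)) (ℤP.<-trans x<y (i<i+1 a))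
... | away x≢a x≢a+1 | right =
  subst₂ _<_ (sym (s-fix a x≢a x≢a+1)) (sym (s-a+1 a)) (ℤP.≤∧≢⇒< (i<j+1⇒i≤j x<y) x≢a)
... | away x≢a x≢a+1 | away y≢a y≢a+1 =
  subst₂ _<_ (sym (s-fix a x≢a x≢a+1)) (sym (s-fix a y≢a y≢a+1)) x<y

evalWord-++ : ∀ p q x → evalWord (p ++ q) x ≡ evalWord p (evalWord q x)
evalWord-++ [] q x = refl
evalWord-++ (a ∷ p) q x = cong (s a) (evalWord-++ p q x)

evalWord-∷ʳ : ∀ p a x → evalWord (p ∷ʳ a) x ≡ evalWord p (s a x)
evalWord-∷ʳ p a x = evalWord-++ p (a ∷ []) x

evalWord-reverse : ∀ p x → evalWord p (evalWord (reverse p) x) ≡ x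
evalWord-reverse [] x = refl
evalWord-reverse (a ∷ p) x = begin
  s a (evalWord p (evalWord (reverse (a ∷ p)) x))
    ≡⟨ cong (λ r → s a (evalWord p (evalWord r x))) (LP.unfold-reverse a p) ⟩
  s a (evalWord p (evalWord (reverse p ∷ʳ a) x))
    ≡⟨ cong (s a ∘ evalWord p) (evalWord-∷ʳ (reverse p) a x) ⟩
  s a (evalWord p (evalWord (reverse p) (s a x)))
    ≡⟨ cong (s a) (evalWord-reverse p (s a x)) ⟩
  s a (s a x)
    ≡⟨ s-involutive a x ⟩
  x ∎
  where open ≡-Reasoning

evalWord-fix-≤ : ∀ {j} p {x} → All (j <_) p → x ≤ j → evalWord p x ≡ x
evalWord-fix-≤ [] _ _ = refl
evalWord-fix-≤ (a ∷ p) (j<a ∷ j<p) x≤j =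
  trans (cong (s a) (evalWord-fix-≤ p j<p x≤j)) (s-fix-< (ℤP.≤-<-trans x≤j j<a))

evalWord-preserves-> : ∀ {j} p {x} → All (j <_) p → j < x → j < evalWord p x
evalWord-preserves-> [] _ j<x = j<x
evalWord-preserves-> (a ∷ p) (j<a ∷ j<p) j<x = s-preserves-> j<a (evalWord-preserves-> p j<p j<x)

-- Finite sums

𝟙 : ∀ {P : Set} → Dec P → ℕ
𝟙 (yes _) = 1
𝟙 (no _) = 0

𝟙-yes : ∀ {P : Set} (d : Dec P) → P → 𝟙 d ≡ 1
𝟙-yes (yes _) _ = refl
𝟙-yes (no ¬p) p = ⊥-elim (¬p p)

𝟙-no : ∀ {P : Set} (d : Dec P) → ¬ P → 𝟙 d ≡ 0
𝟙-no (yes p) ¬p = ⊥-elim (¬p p)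
𝟙-no (no _) _ = refl

𝟙-cong : ∀ {P Q : Set} (d : Dec P) (e : Dec Q) → (P → Q) → (Q → P) → 𝟙 d ≡ 𝟙 e
𝟙-cong (yes _) (yes _) _ _ = refl
𝟙-cong (yes p) (no ¬q) P→Q _ = ⊥-elim (¬q (P→Q p))
𝟙-cong (no ¬p) (yes q) _ Q→P = ⊥-elim (¬p (Q→P q))
𝟙-cong (no _) (no _) _ _ = refl

𝟙-×-dec : ∀ {P Q : Set} (d : Dec P) (e : Dec Q) → 𝟙 (d ×-dec e) ≡ 𝟙 d *ℕ 𝟙 e
𝟙-×-dec (yes _) (yes _) = refl
𝟙-×-dec (yes _) (no _) = refl
𝟙-×-dec (no _) _ = refl

𝟙≤1 : ∀ {P : Set} (d : Dec P) → 𝟙 d ≤ℕ 1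
𝟙≤1 (yes _) = ℕP.≤-refl
𝟙≤1 (no _) = z≤n

module _ {A : Set} where

  ∑ : List A → (A → ℕ) → ℕ
  ∑ [] h = 0
  ∑ (x ∷ xs) h = h x +ℕ ∑ xs h

  ∑-cong : ∀ xs {h g : A → ℕ} → (∀ {x} → x ∈ xs → h x ≡ g x) → ∑ xs h ≡ ∑ xs g
  ∑-cong [] _ = refl
  ∑-cong (x ∷ xs) h≗g = cong₂ _+ℕ_ (h≗g (here refl)) (∑-cong xs (h≗g ∘ there))

  ∑-zero : ∀ xs {h : A → ℕ} → (∀ {x} → x ∈ xs → h x ≡ 0) → ∑ xs h ≡ 0
  ∑-zero [] _ = refl
  ∑-zero (x ∷ xs) h≗0 = cong₂ _+ℕ_ (h≗0 (here refl)) (∑-zero xs (h≗0 ∘ there))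

  ∑-+ : ∀ xs (h g : A → ℕ) → ∑ xs (λ x → h x +ℕ g x) ≡ ∑ xs h +ℕ ∑ xs g
  ∑-+ [] h g = refl
  ∑-+ (x ∷ xs) h g = trans (cong (h x +ℕ g x +ℕ_) (∑-+ xs h g)) (interchange (h x) (g x) (∑ xs h) (∑ xs g))
    where
    interchange : ∀ a b c d → a +ℕ b +ℕ (c +ℕ d) ≡ a +ℕ c +ℕ (b +ℕ d)
    interchange = ℕSolver.solve-∀

  ∑-*ˡ : ∀ xs c (h : A → ℕ) → ∑ xs (λ x → c *ℕ h x) ≡ c *ℕ ∑ xs h
  ∑-*ˡ [] c h = sym (ℕP.*-zeroʳ c)
  ∑-*ˡ (x ∷ xs) c h = trans (cong (c *ℕ h x +ℕ_) (∑-*ˡ xs c h)) (sym (ℕP.*-distribˡ-+ c (h x) (∑ xs h)))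

  ∑-comm : ∀ xs ys (F : A → A → ℕ) → ∑ xs (λ x → ∑ ys (F x)) ≡ ∑ ys (λ y → ∑ xs (λ x → F x y))
  ∑-comm [] ys F = sym (∑-zero ys (λ _ → refl))
  ∑-comm (x ∷ xs) ys F = trans (cong (∑ ys (F x) +ℕ_) (∑-comm xs ys F)) (sym (∑-+ ys (F x) _))

  ∑∑ : List A → (A → A → ℕ) → ℕ
  ∑∑ xs F = ∑ xs (λ x → ∑ xs (F x))

  ∑∑-cong : ∀ xs {F G : A → A → ℕ} → (∀ x y → F x y ≡ G x y) → ∑∑ xs F ≡ ∑∑ xs G
  ∑∑-cong xs F≗G = ∑-cong xs (λ {x} _ → ∑-cong xs (λ {y} _ → F≗G x y))

  ∑∑-+ : ∀ xs (F G : A → A → ℕ) → ∑∑ xs (λ x y → F x y +ℕ G x y) ≡ ∑∑ xs F +ℕ ∑∑ xs G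
  ∑∑-+ xs F G = trans (∑-cong xs (λ {x} _ → ∑-+ xs (F x) (G x))) (∑-+ xs _ _)

module _ {A : Set} (_≟_ : DecidableEquality A) where

  ∑-δ : ∀ {xs c} (h : A → ℕ) → Unique xs → c ∈ xs → ∑ xs (λ x → 𝟙 (x ≟ c) *ℕ h x) ≡ h c
  ∑-δ {x ∷ xs} {c} h (x∉xs ∷ xs!) c∈x∷xs with x ≟ c | c∈x∷xs
  ... | yes refl | _ = trans (cong (h x +ℕ 0 +ℕ_) (∑-zero xs vanish)) (trans (ℕP.+-identityʳ _) (ℕP.+-identityʳ _))
    where
    vanish : ∀ {y} → y ∈ xs → 𝟙 (y ≟ x) *ℕ h y ≡ 0
    vanish y∈xs = cong (_*ℕ _) (𝟙-no (_ ≟ x) (λ y≡x → All.lookup x∉xs y∈xs (sym y≡x)))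
  ... | no x≢c | here c≡x = ⊥-elim (x≢c (sym c≡x))
  ... | no _ | there c∈xs = ∑-δ h xs! c∈xs

  ∑-involution : ∀ {xs} {σ : A → A} (h : A → ℕ) → Unique xs → (∀ x → σ (σ x) ≡ x) →
                 (∀ {x} → x ∈ xs → σ x ∈ xs) → ∑ xs (h ∘ σ) ≡ ∑ xs h
  ∑-involution {xs} {σ} h xs! σσ≗id σ-closed = begin
    ∑ xs (h ∘ σ)
      ≡⟨ ∑-cong xs (λ x∈xs → sym (∑-δ h xs! (σ-closed x∈xs))) ⟩
    ∑ xs (λ x → ∑ xs (λ y → 𝟙 (y ≟ σ x) *ℕ h y))
      ≡⟨ ∑-comm xs xs _ ⟩
    ∑ xs (λ y → ∑ xs (λ x → 𝟙 (y ≟ σ x) *ℕ h y))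
      ≡⟨ ∑-cong xs (λ {y} _ → ∑-cong xs (λ {x} _ →
           cong (_*ℕ h y) (𝟙-cong (y ≟ σ x) (x ≟ σ y) (transpose x y) (transpose y x)))) ⟩
    ∑ xs (λ y → ∑ xs (λ x → 𝟙 (x ≟ σ y) *ℕ h y))
      ≡⟨ ∑-cong xs (λ {y} y∈xs → ∑-δ (λ _ → h y) xs! (σ-closed y∈xs)) ⟩
    ∑ xs h ∎
    where
    open ≡-Reasoning
    transpose : ∀ x y → y ≡ σ x → x ≡ σ y
    transpose x y refl = sym (σσ≗id x)

  ∑∑-δ : ∀ {xs c d} (F : A → A → ℕ) → Unique xs → c ∈ xs → d ∈ xs →
         ∑∑ xs (λ x y → 𝟙 ((x ≟ c) ×-dec (y ≟ d)) *ℕ F x y) ≡ F c d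
  ∑∑-δ {xs} {c} {d} F xs! c∈xs d∈xs = begin
    ∑ xs (λ x → ∑ xs (λ y → 𝟙 ((x ≟ c) ×-dec (y ≟ d)) *ℕ F x y))
      ≡⟨ ∑-cong xs (λ {x} _ → ∑-cong xs (λ {y} _ → split x y)) ⟩
    ∑ xs (λ x → ∑ xs (λ y → 𝟙 (x ≟ c) *ℕ (𝟙 (y ≟ d) *ℕ F x y)))
      ≡⟨ ∑-cong xs (λ {x} _ → ∑-*ˡ xs (𝟙 (x ≟ c)) _) ⟩
    ∑ xs (λ x → 𝟙 (x ≟ c) *ℕ ∑ xs (λ y → 𝟙 (y ≟ d) *ℕ F x y))
      ≡⟨ ∑-δ (λ x → ∑ xs (λ y → 𝟙 (y ≟ d) *ℕ F x y)) xs! c∈xs ⟩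
    ∑ xs (λ y → 𝟙 (y ≟ d) *ℕ F c y)
      ≡⟨ ∑-δ (F c) xs! d∈xs ⟩
    F c d ∎
    where
    open ≡-Reasoning
    split : ∀ x y → 𝟙 ((x ≟ c) ×-dec (y ≟ d)) *ℕ F x y ≡ 𝟙 (x ≟ c) *ℕ (𝟙 (y ≟ d) *ℕ F x y)
    split x y = trans (cong (_*ℕ F x y) (𝟙-×-dec (x ≟ c) (y ≟ d))) (ℕP.*-assoc (𝟙 (x ≟ c)) _ _)

  ∑∑-involution : ∀ {xs} {σ : A → A} (F : A → A → ℕ) → Unique xs → (∀ x → σ (σ x) ≡ x) →
                  (∀ {x} → x ∈ xs → σ x ∈ xs) → ∑∑ xs (λ x y → F (σ x) (σ y)) ≡ ∑∑ xs F
  ∑∑-involution {xs} {σ} F xs! σσ≗id σ-closed =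
    trans (∑-cong xs (λ {x} _ → ∑-involution (F (σ x)) xs! σσ≗id σ-closed))
          (∑-involution (λ x → ∑ xs (F x)) xs! σσ≗id σ-closed)

length-∷ʳ : ∀ {A : Set} (xs : List A) x → length (xs ∷ʳ x) ≡ suc (length xs)
length-∷ʳ xs x = trans (LP.length-++ xs) (ℕP.+-comm _ 1)

All-reverse : ∀ {A : Set} {P : A → Set} {xs} → All P xs → All P (reverse xs)
All-reverse Pxs = All.tabulate (All.lookup Pxs ∘ AnyP.reverse⁻)

unique-length-≤ : ∀ {A : Set} {xs ys : List A} → Unique xs → (∀ {x} → x ∈ xs → x ∈ ys) → length xs ≤ℕ length ys
unique-length-≤ {xs = []} _ _ = z≤n
unique-length-≤ {xs = x ∷ xs} {ys} (x∉xs ∷ xs!) xs⊆ys with ∈P.∈-∃++ (xs⊆ys (here refl))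
... | us , vs , refl = subst (suc (length xs) ≤ℕ_) (sym length-us++x∷vs) (s≤s (unique-length-≤ xs! xs⊆us++vs))
  where
  length-us++x∷vs : length (us ++ x ∷ vs) ≡ suc (length (us ++ vs))
  length-us++x∷vs = trans (LP.length-++ us) (trans (ℕP.+-suc _ _) (cong suc (sym (LP.length-++ us))))
  xs⊆us++vs : ∀ {y} → y ∈ xs → y ∈ us ++ vs
  xs⊆us++vs {y} y∈xs with ∈P.∈-++⁻ us (xs⊆ys (there y∈xs))
  ... | inj₁ y∈us = ∈P.∈-++⁺ˡ y∈us
  ... | inj₂ (here refl) = ⊥-elim (All.lookup x∉xs y∈xs refl)
  ... | inj₂ (there y∈vs) = ∈P.∈-++⁺ʳ us y∈vs

-- Permutations supported in a window

∣∣≤⇒bounds : ∀ {x M} → ∣ x ∣ ≤ℕ M → - (+ M) ≤ x × x ≤ + M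
∣∣≤⇒bounds {+ n} n≤M = ℤP.neg-≤-pos , +≤+ n≤M
∣∣≤⇒bounds { -[1+ n ]} {suc M} (s≤s n≤M) = -≤- n≤M , -≤+

<∣∣⇒outside : ∀ {x M} → M <ℕ ∣ x ∣ → x < - (+ M) ⊎ + M < x
<∣∣⇒outside {+ n} M<n = inj₂ (+<+ M<n)
<∣∣⇒outside { -[1+ n ]} {zero} _ = inj₁ -<+
<∣∣⇒outside { -[1+ n ]} {suc M} (s≤s M<n) = inj₁ (-<- M<n)

+M<x⇒M<∣x∣ : ∀ {M x} → + M < x → M <ℕ ∣ x ∣
+M<x⇒M<∣x∣ {x = + n} (+<+ M<n) = M<n

window : ℕ → List ℤ
window zero = + 0 ∷ []
window (suc M) = -[1+ M ] ∷ + suc M ∷ window M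

∈-window⁻ : ∀ M {x} → x ∈ window M → ∣ x ∣ ≤ℕ M
∈-window⁻ zero (here refl) = z≤n
∈-window⁻ (suc M) (here refl) = ℕP.≤-refl
∈-window⁻ (suc M) (there (here refl)) = ℕP.≤-refl
∈-window⁻ (suc M) (there (there x∈W)) = ℕP.m≤n⇒m≤1+n (∈-window⁻ M x∈W)

∈-window⁺ : ∀ M {x} → ∣ x ∣ ≤ℕ M → x ∈ window M
∈-window⁺ zero {+ zero} _ = here refl
∈-window⁺ (suc M) {+ n} n≤1+M with n ℕP.≟ suc M
... | yes refl = there (here refl)
... | no n≢1+M = there (there (∈-window⁺ M (ℕP.≤-pred (ℕP.≤∧≢⇒< n≤1+M n≢1+M))))
∈-window⁺ (suc M) { -[1+ n ]} 1+n≤1+M with n ℕP.≟ M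
... | yes refl = here refl
... | no n≢M = there (there (∈-window⁺ M (ℕP.≤∧≢⇒< (ℕP.≤-pred 1+n≤1+M) n≢M)))

window-unique : ∀ M → Unique (window M)
window-unique zero = [] ∷ []
window-unique (suc M) =
  ((λ ()) ∷ All.tabulate (outside -[1+ M ] refl)) ∷ All.tabulate (outside (+ suc M) refl) ∷ window-unique M
  where
  outside : ∀ x → ∣ x ∣ ≡ suc M → ∀ {y} → y ∈ window M → x ≢ y
  outside x ∣x∣≡1+M y∈W refl = ℕP.<-irrefl refl (subst (_≤ℕ M) ∣x∣≡1+M (∈-window⁻ M y∈W))

∣a∣<M⇒∈window : ∀ {M a} → ∣ a ∣ <ℕ M → a ∈ window M × a + 1ℤ ∈ window M
∣a∣<M⇒∈window {M} {a} ∣a∣<M = ∈-window⁺ M (ℕP.<⇒≤ ∣a∣<M) , ∈-window⁺ M ∣a+1∣≤M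
  where
  ∣a+1∣≤M : ∣ a + 1ℤ ∣ ≤ℕ M
  ∣a+1∣≤M = ℕP.≤-trans (ℤP.∣i+j∣≤∣i∣+∣j∣ a 1ℤ) (subst (_≤ℕ M) (ℕP.+-comm 1 ∣ a ∣) ∣a∣<M)

s-closed-window : ∀ {M a} → a ∈ window M → a + 1ℤ ∈ window M → ∀ {x} → x ∈ window M → s a x ∈ window M
s-closed-window {a = a} a∈W a+1∈W {x} x∈W with position a x
... | left = subst (_∈ _) (sym (s-a a)) a+1∈W
... | right = subst (_∈ _) (sym (s-a+1 a)) a∈W
... | away x≢a x≢a+1 = subst (_∈ _) (sym (s-fix a x≢a x≢a+1)) x∈W

record Confined (M : ℕ) (f : ℤ → ℤ) : Set where
  field
    fixes-outside : ∀ {x} → M <ℕ ∣ x ∣ → f x ≡ x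
    injective     : ∀ {x y} → f x ≡ f y → x ≡ y
open Confined

confined-window : ∀ {M f x} → Confined M f → ∣ x ∣ ≤ℕ M → ∣ f x ∣ ≤ℕ M
confined-window {M} {f} {x} conf ∣x∣≤M with ∣ f x ∣ ℕP.≤? M
... | yes ∣fx∣≤M = ∣fx∣≤M
... | no ∣fx∣≰M = ⊥-elim (ℕP.<⇒≱ M<∣x∣ ∣x∣≤M)
  where
  M<∣fx∣ : M <ℕ ∣ f x ∣
  M<∣fx∣ = ℕP.≰⇒> ∣fx∣≰M
  M<∣x∣ : M <ℕ ∣ x ∣
  M<∣x∣ = subst (λ y → M <ℕ ∣ y ∣) (injective conf (fixes-outside conf M<∣fx∣)) M<∣fx∣

confined-bounds : ∀ {M f x} → Confined M f → ∣ x ∣ ≤ℕ M → - (+ M) ≤ f x × f x ≤ + M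
confined-bounds conf ∣x∣≤M = ∣∣≤⇒bounds (confined-window conf ∣x∣≤M)

confined-mono : ∀ {M K f} → M ≤ℕ K → Confined M f → Confined K f
confined-mono M≤K conf = record
  { fixes-outside = λ K<∣x∣ → fixes-outside conf (ℕP.≤-<-trans M≤K K<∣x∣)
  ; injective     = injective conf
  }

confined-id : ∀ M → Confined M (λ x → x)
confined-id M = record { fixes-outside = λ _ → refl ; injective = λ x≡y → x≡y }

confined-∘s : ∀ {M f a} → ∣ a ∣ <ℕ M → Confined M f → Confined M (f ∘ s a)
confined-∘s {M} {f} {a} ∣a∣<M conf = record
  { fixes-outside = λ M<∣x∣ →
      trans (cong f (s-fix a (apart M<∣x∣ a∈W) (apart M<∣x∣ a+1∈W))) (fixes-outside conf M<∣x∣)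
  ; injective     = λ {x} {y} fsx≡fsy →
      trans (sym (s-involutive a x)) (trans (cong (s a) (injective conf fsx≡fsy)) (s-involutive a y))
  }
  where
  a∈W : a ∈ window M
  a∈W = proj₁ (∣a∣<M⇒∈window {a = a} ∣a∣<M)
  a+1∈W : a + 1ℤ ∈ window M
  a+1∈W = proj₂ (∣a∣<M⇒∈window {a = a} ∣a∣<M)
  apart : ∀ {x b} → M <ℕ ∣ x ∣ → b ∈ window M → x ≢ b
  apart M<∣x∣ b∈W refl = ℕP.<⇒≱ M<∣x∣ (∈-window⁻ M b∈W)

confined-below : ∀ {M f j y} → Confined M f → j < - (+ M) → j < y → j < f y
confined-below {M} {f} {j} {y} conf j<-M j<y with ∣ y ∣ ℕP.≤? M
... | yes ∣y∣≤M = ℤP.<-≤-trans j<-M (proj₁ (confined-bounds conf ∣y∣≤M))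
... | no ∣y∣≰M = subst (j <_) (sym (fixes-outside conf (ℕP.≰⇒> ∣y∣≰M))) j<y

-- Inversion counts

inversion : (ℤ → ℤ) → ℤ → ℤ → ℕ
inversion f x y = 𝟙 (x <? y) *ℕ 𝟙 (f y <? f x)

inversions : ℕ → (ℤ → ℤ) → ℕ
inversions M f = ∑∑ (window M) (inversion f)

inversion-≮ : ∀ f x y → ¬ x < y → inversion f x y ≡ 0
inversion-≮ f x y x≮y = cong (_*ℕ 𝟙 (f y <? f x)) (𝟙-no (x <? y) x≮y)

inversion-≯ : ∀ f x y → ¬ f y < f x → inversion f x y ≡ 0
inversion-≯ f x y fy≮fx = trans (cong (𝟙 (x <? y) *ℕ_) (𝟙-no (f y <? f x) fy≮fx)) (ℕP.*-zeroʳ (𝟙 (x <? y)))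

inversions-id : ∀ M → inversions M (λ x → x) ≡ 0
inversions-id M = ∑-zero (window M) (λ {x} _ → ∑-zero (window M) (λ {y} _ → none x y))
  where
  none : ∀ x y → inversion (λ z → z) x y ≡ 0
  none x y with ℤP.<-cmp x y
  ... | tri< x<y _ _ = inversion-≯ (λ z → z) x y (ℤP.<-asym x<y)
  ... | tri≈ x≮y _ _ = inversion-≮ (λ z → z) x y x≮y
  ... | tri> x≮y _ _ = inversion-≮ (λ z → z) x y x≮y

inversions-suc : ∀ {M f} → Confined M f → inversions (suc M) f ≡ inversions M f
inversions-suc {M} {f} conf =
  cong₂ _+ℕ_ (∑-zero (window (suc M)) row-bottom)
    (cong₂ _+ℕ_ (∑-zero (window (suc M)) row-top)
      (∑-cong (window M) (λ {x} x∈W →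
        cong₂ _+ℕ_ (col-bottom x∈W) (cong (_+ℕ ∑ (window M) (inversion f x)) (col-top x∈W)))))
  where
  conf′ : Confined (suc M) f
  conf′ = confined-mono (ℕP.n≤1+n M) conf
  bottom top : ℤ
  bottom = -[1+ M ]
  top = + suc M
  bounds : ∀ {z} → z ∈ window (suc M) → bottom ≤ z × z ≤ top
  bounds z∈W = ∣∣≤⇒bounds (∈-window⁻ (suc M) z∈W)
  f-bounds : ∀ {z} → z ∈ window (suc M) → bottom ≤ f z × f z ≤ top
  f-bounds z∈W = confined-bounds conf′ (∈-window⁻ (suc M) z∈W)
  f-bottom : f bottom ≡ bottom
  f-bottom = fixes-outside conf ℕP.≤-refl
  f-top : f top ≡ top
  f-top = fixes-outside conf ℕP.≤-refl
  row-bottom : ∀ {y} → y ∈ window (suc M) → inversion f bottom y ≡ 0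
  row-bottom {y} y∈W = inversion-≯ f bottom y (ℤP.≤⇒≯ (subst (_≤ f y) (sym f-bottom) (proj₁ (f-bounds y∈W))))
  row-top : ∀ {y} → y ∈ window (suc M) → inversion f top y ≡ 0
  row-top {y} y∈W = inversion-≮ f top y (ℤP.≤⇒≯ (proj₂ (bounds y∈W)))
  col-bottom : ∀ {x} → x ∈ window M → inversion f x bottom ≡ 0
  col-bottom {x} x∈W = inversion-≮ f x bottom (ℤP.≤⇒≯ (proj₁ (bounds (there (there x∈W)))))
  col-top : ∀ {x} → x ∈ window M → inversion f x top ≡ 0
  col-top {x} x∈W =
    inversion-≯ f x top (ℤP.≤⇒≯ (subst (f x ≤_) (sym f-top) (proj₂ (f-bounds (there (there x∈W))))))

inversions-window : ∀ {M K f} → Confined M f → M ≤ℕ K → inversions K f ≡ inversions M f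
inversions-window {M} {K} {f} conf M≤K = go (ℕP.≤⇒≤′ M≤K)
  where
  go : ∀ {K} → M ≤′ K → inversions K f ≡ inversions M f
  go ≤′-refl = refl
  go (≤′-step M≤′K) = trans (inversions-suc (confined-mono (ℕP.≤′⇒≤ M≤′K) conf)) (go M≤′K)

-- s a keeps the order of every pair except (a, a + 1) and (a + 1, a).
s-order : ∀ a x y → 𝟙 (s a x <? s a y) +ℕ 𝟙 ((x ℤP.≟ a) ×-dec (y ℤP.≟ a + 1ℤ))
                  ≡ 𝟙 (x <? y) +ℕ 𝟙 ((x ℤP.≟ a + 1ℤ) ×-dec (y ℤP.≟ a))
s-order a x y with (x ℤP.≟ a) ×-dec (y ℤP.≟ a + 1ℤ) | (x ℤP.≟ a + 1ℤ) ×-dec (y ℤP.≟ a)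
... | yes (refl , refl) | yes (a≡a+1 , _) = ⊥-elim (i≢i+1 a a≡a+1)
... | yes (refl , refl) | no _ =
  trans (cong (_+ℕ 1) (𝟙-no (s a a <? s a (a + 1ℤ)) (λ lt → ℤP.<-asym (subst₂ _<_ (s-a a) (s-a+1 a) lt) (i<i+1 a))))
        (sym (cong (_+ℕ 0) (𝟙-yes (a <? a + 1ℤ) (i<i+1 a))))
... | no _ | yes (refl , refl) =
  trans (cong (_+ℕ 0) (𝟙-yes (s a (a + 1ℤ) <? s a a) (subst₂ _<_ (sym (s-a+1 a)) (sym (s-a a)) (i<i+1 a))))
        (sym (cong (_+ℕ 1) (𝟙-no (a + 1ℤ <? a) (ℤP.<-asym (i<i+1 a)))))
... | no not-a,a+1 | no not-a+1,a =
  cong (_+ℕ 0) (𝟙-cong (s a x <? s a y) (x <? y) reflect (λ x<y → s-preserves-< a x<y not-a,a+1))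
  where
  reflect : s a x < s a y → x < y
  reflect sx<sy = subst₂ _<_ (s-involutive a x) (s-involutive a y) (s-preserves-< a sx<sy not-swapped)
    where
    not-swapped : ¬ (s a x ≡ a × s a y ≡ a + 1ℤ)
    not-swapped (sx≡a , sy≡a+1) = not-a+1,a
      ( trans (sym (s-involutive a x)) (trans (cong (s a) sx≡a) (s-a a))
      , trans (sym (s-involutive a y)) (trans (cong (s a) sy≡a+1) (s-a+1 a)) )

inversions-∘s : ∀ M f {a} → a ∈ window M → a + 1ℤ ∈ window M →
  inversions M (f ∘ s a) +ℕ 𝟙 (f (a + 1ℤ) <? f a) ≡ inversions M f +ℕ 𝟙 (f a <? f (a + 1ℤ))
inversions-∘s M f {a} a∈W a+1∈W = begin
  inversions M (f ∘ s a) +ℕ Q a (a + 1ℤ)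
    ≡⟨ cong₂ _+ℕ_ reindexed (sym (∑∑-δ ℤP._≟_ Q W! a∈W a+1∈W)) ⟩
  ∑∑ W G +ℕ ∑∑ W (λ x y → 𝟙 ((x ℤP.≟ a) ×-dec (y ℤP.≟ a + 1ℤ)) *ℕ Q x y)
    ≡⟨ sym (∑∑-+ W G _) ⟩
  ∑∑ W (λ x y → G x y +ℕ 𝟙 ((x ℤP.≟ a) ×-dec (y ℤP.≟ a + 1ℤ)) *ℕ Q x y)
    ≡⟨ ∑∑-cong W pointwise ⟩
  ∑∑ W (λ x y → inversion f x y +ℕ 𝟙 ((x ℤP.≟ a + 1ℤ) ×-dec (y ℤP.≟ a)) *ℕ Q x y)
    ≡⟨ ∑∑-+ W (inversion f) _ ⟩
  inversions M f +ℕ ∑∑ W (λ x y → 𝟙 ((x ℤP.≟ a + 1ℤ) ×-dec (y ℤP.≟ a)) *ℕ Q x y)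
    ≡⟨ cong (inversions M f +ℕ_) (∑∑-δ ℤP._≟_ Q W! a+1∈W a∈W) ⟩
  inversions M f +ℕ Q (a + 1ℤ) a ∎
  where
  open ≡-Reasoning
  W : List ℤ
  W = window M
  W! : Unique W
  W! = window-unique M
  Q : ℤ → ℤ → ℕ
  Q x y = 𝟙 (f y <? f x)
  G : ℤ → ℤ → ℕ
  G x y = 𝟙 (s a x <? s a y) *ℕ Q x y
  reindexed : inversions M (f ∘ s a) ≡ ∑∑ W G
  reindexed = trans
    (∑∑-cong W (λ x y → cong (_*ℕ 𝟙 (f (s a y) <? f (s a x)))
      (sym (cong₂ (λ u v → 𝟙 (u <? v)) (s-involutive a x) (s-involutive a y)))))
    (∑∑-involution ℤP._≟_ G W! (s-involutive a) (s-closed-window a∈W a+1∈W))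
  pointwise : ∀ x y → G x y +ℕ 𝟙 ((x ℤP.≟ a) ×-dec (y ℤP.≟ a + 1ℤ)) *ℕ Q x y
                    ≡ inversion f x y +ℕ 𝟙 ((x ℤP.≟ a + 1ℤ) ×-dec (y ℤP.≟ a)) *ℕ Q x y
  pointwise x y = trans (sym (ℕP.*-distribʳ-+ (Q x y) (𝟙 (s a x <? s a y)) _))
                        (trans (cong (_*ℕ Q x y) (s-order a x y)) (ℕP.*-distribʳ-+ (Q x y) (𝟙 (x <? y)) _))

inversions-cong : ∀ M {f g} → (∀ x → f x ≡ g x) → inversions M f ≡ inversions M g
inversions-cong M {f} {g} f≗g =
  ∑∑-cong (window M) (λ x y → cong (𝟙 (x <? y) *ℕ_) (cong₂ (λ u v → 𝟙 (u <? v)) (f≗g y) (f≗g x)))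

inversions-∘s-descent : ∀ M f {a} → ∣ a ∣ <ℕ M → f (a + 1ℤ) < f a →
                        suc (inversions M (f ∘ s a)) ≡ inversions M f
inversions-∘s-descent M f {a} ∣a∣<M desc = begin
  suc (inversions M (f ∘ s a))
    ≡⟨ ℕP.+-comm 1 _ ⟩
  inversions M (f ∘ s a) +ℕ 1
    ≡⟨ cong (inversions M (f ∘ s a) +ℕ_) (sym (𝟙-yes (f (a + 1ℤ) <? f a) desc)) ⟩
  inversions M (f ∘ s a) +ℕ 𝟙 (f (a + 1ℤ) <? f a)
    ≡⟨ uncurry (inversions-∘s M f) (∣a∣<M⇒∈window ∣a∣<M) ⟩
  inversions M f +ℕ 𝟙 (f a <? f (a + 1ℤ))
    ≡⟨ cong (inversions M f +ℕ_) (𝟙-no (f a <? f (a + 1ℤ)) (ℤP.<-asym desc)) ⟩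
  inversions M f +ℕ 0
    ≡⟨ ℕP.+-identityʳ _ ⟩
  inversions M f ∎
  where open ≡-Reasoning

inversions-∘s-ascent : ∀ M f {a} → ∣ a ∣ <ℕ M → f a < f (a + 1ℤ) →
                       inversions M (f ∘ s a) ≡ suc (inversions M f)
inversions-∘s-ascent M f {a} ∣a∣<M asc = begin
  inversions M (f ∘ s a)
    ≡⟨ sym (ℕP.+-identityʳ _) ⟩
  inversions M (f ∘ s a) +ℕ 0
    ≡⟨ cong (inversions M (f ∘ s a) +ℕ_) (sym (𝟙-no (f (a + 1ℤ) <? f a) (ℤP.<-asym asc))) ⟩
  inversions M (f ∘ s a) +ℕ 𝟙 (f (a + 1ℤ) <? f a)
    ≡⟨ uncurry (inversions-∘s M f) (∣a∣<M⇒∈window ∣a∣<M) ⟩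
  inversions M f +ℕ 𝟙 (f a <? f (a + 1ℤ))
    ≡⟨ cong (inversions M f +ℕ_) (𝟙-yes (f a <? f (a + 1ℤ)) asc) ⟩
  inversions M f +ℕ 1
    ≡⟨ ℕP.+-comm _ 1 ⟩
  suc (inversions M f) ∎
  where open ≡-Reasoning

inversions-∘s-≤ : ∀ M f {a} → ∣ a ∣ <ℕ M → inversions M (f ∘ s a) ≤ℕ suc (inversions M f)
inversions-∘s-≤ M f {a} ∣a∣<M = begin
  inversions M (f ∘ s a)
    ≤⟨ ℕP.m≤m+n _ _ ⟩
  inversions M (f ∘ s a) +ℕ 𝟙 (f (a + 1ℤ) <? f a)
    ≡⟨ uncurry (inversions-∘s M f) (∣a∣<M⇒∈window ∣a∣<M) ⟩
  inversions M f +ℕ 𝟙 (f a <? f (a + 1ℤ))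
    ≤⟨ ℕP.+-monoʳ-≤ (inversions M f) (𝟙≤1 (f a <? f (a + 1ℤ))) ⟩
  inversions M f +ℕ 1
    ≡⟨ ℕP.+-comm _ 1 ⟩
  suc (inversions M f) ∎
  where open ℕP.≤-Reasoning

-- The statistic θ

θ : (ℤ → ℤ) → ℤ → Set
θ f j = Σ ℤ (λ j′ → j < j′ × f j′ < f j)

θ-in-window : ∀ {M f j} → Confined M f → θ f j → ∣ j ∣ ≤ℕ M
θ-in-window {M} {f} {j} conf (j′ , j<j′ , fj′<fj) with ∣ j ∣ ℕP.≤? M
... | yes ∣j∣≤M = ∣j∣≤M
... | no ∣j∣≰M with <∣∣⇒outside (ℕP.≰⇒> ∣j∣≰M) | fixes-outside conf (ℕP.≰⇒> ∣j∣≰M)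
...   | inj₁ j<-M | fj≡j = ⊥-elim (ℤP.<-asym fj′<fj (subst (_< f j′) (sym fj≡j) (confined-below conf j<-M j<j′)))
...   | inj₂ M<j | fj≡j = ⊥-elim (ℤP.<-asym fj′<fj (subst₂ _<_ (sym fj≡j) (sym fj′≡j′) j<j′))
  where
  fj′≡j′ : f j′ ≡ j′
  fj′≡j′ = fixes-outside conf (+M<x⇒M<∣x∣ (ℤP.<-trans M<j j<j′))

θ-witness-in-window : ∀ {M f j j′} → Confined M f → ∣ j ∣ ≤ℕ M → j < j′ → f j′ < f j → ∣ j′ ∣ ≤ℕ M
θ-witness-in-window {M} {f} {j} {j′} conf ∣j∣≤M j<j′ fj′<fj with ∣ j′ ∣ ℕP.≤? M
... | yes ∣j′∣≤M = ∣j′∣≤M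
... | no ∣j′∣≰M with <∣∣⇒outside (ℕP.≰⇒> ∣j′∣≰M) | fixes-outside conf (ℕP.≰⇒> ∣j′∣≰M)
...   | inj₁ j′<-M | _ = ⊥-elim (ℤP.<-asym j′<-M (ℤP.≤-<-trans (proj₁ (∣∣≤⇒bounds ∣j∣≤M)) j<j′))
...   | inj₂ M<j′ | fj′≡j′ =
  ⊥-elim (ℤP.<-asym fj′<fj (ℤP.≤-<-trans (proj₂ (confined-bounds conf ∣j∣≤M)) (subst (+ M <_) (sym fj′≡j′) M<j′)))

θ? : ∀ {M f} → Confined M f → ∀ j → Dec (θ f j)
θ? {M} {f} conf j with ∣ j ∣ ℕP.≤? M
... | no ∣j∣≰M = no (∣j∣≰M ∘ θ-in-window conf)
... | yes ∣j∣≤M with any? (λ j′ → (j <? j′) ×-dec (f j′ <? f j)) (window M)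
...   | yes witness = let j′ , _ , later-smaller = find witness in yes (j′ , later-smaller)
...   | no no-witness = no (λ (j′ , j<j′ , fj′<fj) →
  no-witness (lose (∈-window⁺ M (θ-witness-in-window conf ∣j∣≤M j<j′ fj′<fj)) (j<j′ , fj′<fj)))

θ-descent : ∀ {f a} → θ f a → ¬ θ f (a + 1ℤ) → f (a + 1ℤ) < f a
θ-descent {f} {a} (j′ , a<j′ , fj′<fa) ¬θa+1 with ℤP.<-cmp (a + 1ℤ) j′
... | tri< a+1<j′ _ _ = ℤP.≤-<-trans (ℤP.≮⇒≥ (λ fj′<fa+1 → ¬θa+1 (j′ , a+1<j′ , fj′<fa+1))) fj′<fa
... | tri≈ _ refl _ = fj′<fa
... | tri> _ _ j′<a+1 = ⊥-elim (ℤP.<⇒≱ j′<a+1 (i<j⇒i+1≤j a<j′))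

θ-∘s-self : ∀ {f a} → f (a + 1ℤ) < f a → ¬ θ f (a + 1ℤ) → ¬ θ (f ∘ s a) a
θ-∘s-self {f} {a} desc ¬θa+1 (j′ , a<j′ , gj′<ga) with position a j′
... | left = ℤP.<-irrefl refl a<j′
... | right = ℤP.<-asym desc (subst₂ _<_ (cong f (s-a+1 a)) (cong f (s-a a)) gj′<ga)
... | away j′≢a j′≢a+1 = ¬θa+1
  (j′ , ℤP.≤∧≢⇒< (i<j⇒i+1≤j a<j′) (j′≢a+1 ∘ sym) , subst₂ _<_ (cong f (s-fix a j′≢a j′≢a+1)) (cong f (s-a a)) gj′<ga)

θ-∘s-below : ∀ {f a j} → j < a → θ f j → θ (f ∘ s a) j
θ-∘s-below {f} {a} {j} j<a (j′ , j<j′ , fj′<fj) =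
    s a j′
  , s-preserves-> j<a j<j′
  , subst₂ _<_ (cong f (sym (s-involutive a j′))) (cong f (sym (s-fix-< j<a))) fj′<fj

-- Reduced words

monotone-by-steps : ∀ (g : ℤ → ℤ) → (∀ a → g a ≤ g (a + 1ℤ)) → ∀ {x y} → x ≤ y → g x ≤ g y
monotone-by-steps g step {x} {y} x≤y = subst (λ t → g x ≤ g t) x+[y-x]≡y (climb ∣ y - x ∣)
  where
  climb : ∀ k → g x ≤ g (x + + k)
  climb zero = ℤP.≤-reflexive (cong g (sym (ℤP.+-identityʳ x)))
  climb (suc k) = ℤP.≤-trans (climb k) (subst (λ t → g (x + + k) ≤ g t) (+-assoc-1 x (+ k)) (step (x + + k)))
    where
    +-assoc-1 : ∀ x t → x + t + 1ℤ ≡ x + (1ℤ + t)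
    +-assoc-1 = solve-∀
  x+[y-x]≡y : x + + ∣ y - x ∣ ≡ y
  x+[y-x]≡y = trans (cong (λ t → x + t) (ℤP.0≤i⇒+∣i∣≡i (ℤP.i≤j⇒0≤j-i x≤y))) (x+[y-x] x y)
    where
    x+[y-x] : ∀ x y → x + (y - x) ≡ y
    x+[y-x] = solve-∀

-- The displacement f x - x is monotone and vanishes at ±(M + 1).
increasing-confined⇒id : ∀ {M f} → Confined M f → (∀ a → f a < f (a + 1ℤ)) → ∀ x → f x ≡ x
increasing-confined⇒id {M} {f} conf increasing x with ∣ x ∣ ℕP.≤? M
... | no ∣x∣≰M = fixes-outside conf (ℕP.≰⇒> ∣x∣≰M)
... | yes ∣x∣≤M = ℤP.i-j≡0⇒i≡j (f x) x (ℤP.≤-antisym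
      (subst (displacement x ≤_) (displacement-outside (+ suc M) refl)
        (monotone-by-steps displacement step (proj₂ x-bounds)))
      (subst (_≤ displacement x) (displacement-outside -[1+ M ] refl)
        (monotone-by-steps displacement step (proj₁ x-bounds))))
  where
  displacement : ℤ → ℤ
  displacement y = f y - y
  step : ∀ a → displacement a ≤ displacement (a + 1ℤ)
  step a = subst (f a - a ≤_) (shift (f (a + 1ℤ)) a) (ℤP.+-monoˡ-≤ (- a) (i<j⇒i≤j-1 (increasing a)))
    where
    shift : ∀ b a → b - 1ℤ - a ≡ b - (a + 1ℤ)
    shift = solve-∀
  displacement-outside : ∀ y → ∣ y ∣ ≡ suc M → displacement y ≡ + 0
  displacement-outside y ∣y∣≡1+M =
    trans (cong (_- y) (fixes-outside conf (ℕP.≤-reflexive (sym ∣y∣≡1+M)))) (ℤP.+-inverseʳ y)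
  x-bounds : -[1+ M ] ≤ x × x ≤ + suc M
  x-bounds = ∣∣≤⇒bounds (ℕP.m≤n⇒m≤1+n ∣x∣≤M)

IsWordFor : (ℤ → ℤ) → List ℤ → Set
IsWordFor f p = ∀ x → evalWord p x ≡ f x

IsReducedWordFor : (ℤ → ℤ) → List ℤ → Set
IsReducedWordFor f p = IsWordFor f p × (∀ q → IsWordFor f q → length p ≤ℕ length q)

word-∷ʳ : ∀ {f a} p → IsWordFor (f ∘ s a) p → IsWordFor f (p ∷ʳ a)
word-∷ʳ {f} {a} p word x = trans (evalWord-∷ʳ p a x) (trans (word (s a x)) (cong f (s-involutive a x)))

word-∷ʳ⁻ : ∀ {f a} p → IsWordFor f (p ∷ʳ a) → IsWordFor (f ∘ s a) p
word-∷ʳ⁻ {f} {a} p word x =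
  trans (cong (evalWord p) (sym (s-involutive a x))) (trans (sym (evalWord-∷ʳ p a (s a x))) (word (s a x)))

radius : List ℤ → ℕ
radius [] = 0
radius (a ∷ p) = suc ∣ a ∣ +ℕ radius p

letters-within : ∀ p {K} → radius p ≤ℕ K → All (λ a → ∣ a ∣ <ℕ K) p
letters-within [] _ = []
letters-within (a ∷ p) r≤K =
  ℕP.≤-trans (ℕP.m≤m+n _ _) r≤K ∷ letters-within p (ℕP.≤-trans (ℕP.m≤n+m _ _) r≤K)

confined-∘evalWord : ∀ {K h} p → All (λ a → ∣ a ∣ <ℕ K) p → Confined K h → Confined K (h ∘ evalWord p)
confined-∘evalWord [] _ conf = conf
confined-∘evalWord (a ∷ p) (∣a∣<K ∷ within) conf = confined-∘evalWord p within (confined-∘s ∣a∣<K conf)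

inversions-∘evalWord : ∀ {K} h p → All (λ a → ∣ a ∣ <ℕ K) p →
                       inversions K (h ∘ evalWord p) ≤ℕ inversions K h +ℕ length p
inversions-∘evalWord {K} h [] _ = ℕP.m≤m+n _ _
inversions-∘evalWord {K} h (a ∷ p) (∣a∣<K ∷ within) = begin
  inversions K (h ∘ s a ∘ evalWord p)        ≤⟨ inversions-∘evalWord (h ∘ s a) p within ⟩
  inversions K (h ∘ s a) +ℕ length p         ≤⟨ ℕP.+-monoˡ-≤ (length p) (inversions-∘s-≤ K h ∣a∣<K) ⟩
  suc (inversions K h) +ℕ length p           ≡⟨ sym (ℕP.+-suc _ _) ⟩
  inversions K h +ℕ length (a ∷ p)           ∎
  where open ℕP.≤-Reasoning

inversions≤length : ∀ {M f} q → Confined M f → IsWordFor f q → inversions M f ≤ℕ length q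
inversions≤length {M} {f} q conf word = begin
  inversions M f
    ≡⟨ sym (inversions-window conf (ℕP.m≤m+n M (radius q))) ⟩
  inversions K f
    ≡⟨ inversions-cong K (sym ∘ word) ⟩
  inversions K (evalWord q)
    ≤⟨ inversions-∘evalWord (λ x → x) q (letters-within q (ℕP.m≤n+m _ M)) ⟩
  inversions K (λ x → x) +ℕ length q
    ≡⟨ cong (_+ℕ length q) (inversions-id K) ⟩
  length q ∎
  where
  open ℕP.≤-Reasoning
  K : ℕ
  K = M +ℕ radius q

descent-step : ∀ {M f a} → Confined M f → ∣ a ∣ ≤ℕ M → f (a + 1ℤ) < f a →
               Confined (suc M) (f ∘ s a) × suc (inversions (suc M) (f ∘ s a)) ≡ inversions M f
descent-step {M} {f} {a} conf ∣a∣≤M desc =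
    confined-∘s (s≤s ∣a∣≤M) (confined-mono (ℕP.n≤1+n M) conf)
  , trans (inversions-∘s-descent (suc M) f (s≤s ∣a∣≤M) desc) (inversions-suc conf)

word-of-inversions : ∀ n {M f} → Confined M f → inversions M f ≡ n →
                     Σ (List ℤ) λ q → IsWordFor f q × length q ≡ n
word-ending-at-descent : ∀ n {M f a} → Confined M f → ∣ a ∣ ≤ℕ M → f (a + 1ℤ) < f a → inversions M f ≡ n →
                         Σ (List ℤ) λ q → IsWordFor f q × length q ≡ n

word-of-inversions n {M} {f} conf inv≡n with any? (λ a → f (a + 1ℤ) <? f a) (window M)
... | yes descent =
  let a , a∈W , desc = find descent in word-ending-at-descent n conf (∈-window⁻ M a∈W) desc inv≡n
... | no no-descent =
  [] , sym ∘ f≗id , trans (sym (inversions-id M)) (trans (sym (inversions-cong M f≗id)) inv≡n)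
  where
  increasing : ∀ a → f a < f (a + 1ℤ)
  increasing a with ℤP.<-cmp (f a) (f (a + 1ℤ))
  ... | tri< fa<fa+1 _ _ = fa<fa+1
  ... | tri≈ _ fa≡fa+1 _ = ⊥-elim (i≢i+1 a (injective conf fa≡fa+1))
  ... | tri> _ _ desc =
    ⊥-elim (no-descent (lose (∈-window⁺ M (θ-in-window conf (a + 1ℤ , i<i+1 a , desc))) desc))
  f≗id : ∀ x → f x ≡ x
  f≗id = increasing-confined⇒id conf increasing

word-ending-at-descent zero conf ∣a∣≤M desc inv≡0 =
  ⊥-elim (ℕP.1+n≢0 (trans (proj₂ (descent-step conf ∣a∣≤M desc)) inv≡0))
word-ending-at-descent (suc n) {a = a} conf ∣a∣≤M desc inv≡1+n =
  let conf′ , 1+inv′≡inv = descent-step conf ∣a∣≤M desc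
      q , word , length≡n = word-of-inversions n conf′ (ℕP.suc-injective (trans 1+inv′≡inv inv≡1+n))
  in q ∷ʳ a , word-∷ʳ q word , trans (length-∷ʳ q a) (cong suc length≡n)

length≡inversions⇒reduced : ∀ {M f} q → Confined M f → IsWordFor f q → length q ≡ inversions M f →
                             IsReducedWordFor f q
length≡inversions⇒reduced q conf word length≡inv =
  word , λ q′ word′ → subst (_≤ℕ length q′) (sym length≡inv) (inversions≤length q′ conf word′)

reduced-exists : ∀ {M f} → Confined M f → Σ (List ℤ) (IsReducedWordFor f)
reduced-exists {M} {f} conf with word-of-inversions (inversions M f) conf refl
... | q , word , length≡inv = q , length≡inversions⇒reduced q conf word length≡inv

reduced⇒length≡inversions : ∀ {M f} p → Confined M f → IsReducedWordFor f p → length p ≡ inversions M f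
reduced⇒length≡inversions {M} {f} p conf (word , minimal) with word-of-inversions (inversions M f) conf refl
... | q , word′ , length≡inv =
  ℕP.≤-antisym (subst (length p ≤ℕ_) length≡inv (minimal q word′)) (inversions≤length p conf word)

reduced-prefix : ∀ {f} p q → IsReducedWordFor f (p ++ q) → IsReducedWordFor (evalWord p) p
reduced-prefix {f} p q (word , minimal) = (λ _ → refl) , λ p′ word′ →
  ℕP.+-cancelʳ-≤ (length q) (length p) (length p′)
    (subst₂ _≤ℕ_ (LP.length-++ p) (LP.length-++ p′) (minimal (p′ ++ q) (λ x → begin
      evalWord (p′ ++ q) x          ≡⟨ evalWord-++ p′ q x ⟩
      evalWord p′ (evalWord q x)    ≡⟨ word′ (evalWord q x) ⟩
      evalWord p (evalWord q x)     ≡⟨ sym (evalWord-++ p q x) ⟩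
      evalWord (p ++ q) x           ≡⟨ word x ⟩
      f x                           ∎)))
  where open ≡-Reasoning

reduced-∷ʳ : ∀ {M f a} p → Confined M f → ∣ a ∣ ≤ℕ M → f (a + 1ℤ) < f a →
             IsReducedWordFor (f ∘ s a) p → IsReducedWordFor f (p ∷ʳ a)
reduced-∷ʳ {M} {f} {a} p conf ∣a∣≤M desc reduced =
  length≡inversions⇒reduced (p ∷ʳ a) conf (word-∷ʳ p (proj₁ reduced)) (begin
  length (p ∷ʳ a)                             ≡⟨ length-∷ʳ p a ⟩
  suc (length p)                              ≡⟨ cong suc (reduced⇒length≡inversions p conf′ reduced) ⟩
  suc (inversions (suc M) (f ∘ s a))          ≡⟨ 1+inv′≡inv ⟩
  inversions M f                              ∎)
  where
  open ≡-Reasoning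
  conf′ : Confined (suc M) (f ∘ s a)
  conf′ = proj₁ (descent-step conf ∣a∣≤M desc)
  1+inv′≡inv : suc (inversions (suc M) (f ∘ s a)) ≡ inversions M f
  1+inv′≡inv = proj₂ (descent-step conf ∣a∣≤M desc)

-- Otherwise p, a word for f ∘ s a, would be shorter than its inversion count.
reduced⇒last-descent : ∀ {M f a} p → Confined M f → IsReducedWordFor f (p ∷ʳ a) → f (a + 1ℤ) < f a
reduced⇒last-descent {M} {f} {a} p conf reduced with ℤP.<-cmp (f (a + 1ℤ)) (f a)
... | tri< desc _ _ = desc
... | tri≈ _ fa+1≡fa _ = ⊥-elim (i≢i+1 a (sym (injective conf fa+1≡fa)))
... | tri> _ _ asc = ⊥-elim (ℕP.<-irrefl refl (begin-strict
  length p                                    <⟨ ℕP.n<1+n _ ⟩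
  suc (length p)                              ≡⟨ sym (length-∷ʳ p a) ⟩
  length (p ∷ʳ a)                             ≡⟨ reduced⇒length≡inversions (p ∷ʳ a) conf reduced ⟩
  inversions M f                              ≡⟨ sym (inversions-window conf (ℕP.m≤m+n M _)) ⟩
  inversions K f                              <⟨ ℕP.n<1+n _ ⟩
  suc (inversions K f)                        ≡⟨ sym (inversions-∘s-ascent K f ∣a∣<K asc) ⟩
  inversions K (f ∘ s a)                      ≤⟨ inversions≤length p conf′ (word-∷ʳ⁻ p (proj₁ reduced)) ⟩
  length p                                    ∎))
  where
  open ℕP.≤-Reasoning
  K : ℕ
  K = M +ℕ suc ∣ a ∣
  ∣a∣<K : ∣ a ∣ <ℕ K
  ∣a∣<K = ℕP.m≤n+m _ M
  conf′ : Confined K (f ∘ s a)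
  conf′ = confined-∘s ∣a∣<K (confined-mono (ℕP.m≤m+n M _) conf)

-- Increasing suffixes

dp-head : ∀ x r → x ∈ dp x r
dp-head x [] = here refl
dp-head x (y ∷ r) with y <? x
... | yes _ = here refl
... | no _ = here refl

dp-≤ : ∀ x r {j} → j ∈ dp x r → j ≤ x
dp-≤ x [] (here refl) = ℤP.≤-refl
dp-≤ x (y ∷ r) j∈ with y <? x | j∈
... | yes _ | here refl = ℤP.≤-refl
... | yes y<x | there j∈′ = ℤP.≤-trans (dp-≤ y r j∈′) (ℤP.<⇒≤ y<x)
... | no _ | here refl = ℤP.≤-refl

dp-cons : ∀ {x y} r → y < x → dp x (y ∷ r) ≡ x ∷ dp y r
dp-cons {x} {y} r y<x with y <? x
... | yes _ = refl
... | no y≮x = ⊥-elim (y≮x y<x)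

dp-unique : ∀ x r → Unique (dp x r)
dp-unique x [] = [] ∷ []
dp-unique x (y ∷ r) with y <? x
... | yes y<x = All.tabulate (λ j∈ x≡j → ℤP.<-irrefl (sym x≡j) (ℤP.≤-<-trans (dp-≤ y r j∈) y<x)) ∷ dp-unique y r
... | no _ = [] ∷ []

decPrefix-split : ∀ r {j} → j ∈ decPrefix r →
  Σ (List ℤ) λ pre → Σ (List ℤ) λ post → r ≡ pre ++ j ∷ post × All (j <_) pre
decPrefix-split (x ∷ []) (here refl) = [] , [] , refl , []
decPrefix-split (x ∷ y ∷ r) j∈ with y <? x | j∈
... | yes _ | here refl = [] , y ∷ r , refl , []
... | yes y<x | there j∈′ with decPrefix-split (y ∷ r) j∈′
...   | pre , post , eq , j<pre = x ∷ pre , post , cong (x ∷_) eq , ℤP.≤-<-trans (dp-≤ y r j∈′) y<x ∷ j<pre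
decPrefix-split (x ∷ y ∷ r) j∈ | no _ | here refl = [] , y ∷ r , refl , []

IncSuf-split : ∀ p {j} → j ∈ IncSuf p → Σ (List ℤ) λ u → Σ (List ℤ) λ v → p ≡ (u ∷ʳ j) ++ v × All (j <_) v
IncSuf-split p {j} j∈ with decPrefix-split (reverse p) (AnyP.reverse⁻ j∈)
... | pre , post , eq , j<pre = reverse post , reverse pre , p≡ , All-reverse j<pre
  where
  open ≡-Reasoning
  p≡ : p ≡ (reverse post ∷ʳ j) ++ reverse pre
  p≡ = begin
    p                                  ≡⟨ sym (LP.reverse-involutive p) ⟩
    reverse (reverse p)                ≡⟨ cong reverse eq ⟩
    reverse (pre ++ j ∷ post)          ≡⟨ LP.reverse-++ pre (j ∷ post) ⟩
    reverse (j ∷ post) ++ reverse pre  ≡⟨ cong (_++ reverse pre) (LP.unfold-reverse j post) ⟩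
    (reverse post ∷ʳ j) ++ reverse pre ∎

IncSuf-∷ʳ : ∀ q x → IncSuf (q ∷ʳ x) ≡ reverse (dp x (reverse q))
IncSuf-∷ʳ q x = cong (reverse ∘ decPrefix) (LP.reverse-++ q (x ∷ []))

IncSuf-∷ʳ-∷ʳ : ∀ q {x y} → y < x → IncSuf (q ∷ʳ y ∷ʳ x) ≡ IncSuf (q ∷ʳ y) ∷ʳ x
IncSuf-∷ʳ-∷ʳ q {x} {y} y<x = begin
  IncSuf (q ∷ʳ y ∷ʳ x)                      ≡⟨ IncSuf-∷ʳ (q ∷ʳ y) x ⟩
  reverse (dp x (reverse (q ∷ʳ y)))         ≡⟨ cong (reverse ∘ dp x) (LP.reverse-++ q (y ∷ [])) ⟩
  reverse (dp x (y ∷ reverse q))            ≡⟨ cong reverse (dp-cons (reverse q) y<x) ⟩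
  reverse (x ∷ dp y (reverse q))            ≡⟨ LP.unfold-reverse x (dp y (reverse q)) ⟩
  reverse (dp y (reverse q)) ∷ʳ x           ≡⟨ cong (_∷ʳ x) (sym (IncSuf-∷ʳ q y)) ⟩
  IncSuf (q ∷ʳ y) ∷ʳ x                      ∎
  where open ≡-Reasoning

last-∈-IncSuf : ∀ q x → x ∈ IncSuf (q ∷ʳ x)
last-∈-IncSuf q x = subst (x ∈_) (sym (IncSuf-∷ʳ q x)) (AnyP.reverse⁺ (dp-head x (reverse q)))

IncSuf-≤-last : ∀ q x {j} → j ∈ IncSuf (q ∷ʳ x) → j ≤ x
IncSuf-≤-last q x j∈ = dp-≤ x (reverse q) (AnyP.reverse⁻ (subst (_ ∈_) (IncSuf-∷ʳ q x) j∈))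

IncSuf-unique : ∀ p → Unique (IncSuf p)
IncSuf-unique p =
  ↭ₛ-Properties.Unique-resp-↭ (setoid ℤ) (↭⇒↭ₛ (↭-sym (↭-reverse (decPrefix (reverse p)))))
    (decPrefix-unique (reverse p))
  where
  decPrefix-unique : ∀ r → Unique (decPrefix r)
  decPrefix-unique [] = []
  decPrefix-unique (x ∷ r) = dp-unique x r

IncSufUpTo : ℤ → List ℤ → List ℤ
IncSufUpTo c p with reverse p
... | [] = []
... | x ∷ _ with x ≤? c
...   | yes _ = IncSuf p
...   | no _ = []

Iw≡length-IncSufUpTo : ∀ c p → Iw c p ≡ length (IncSufUpTo c p)
Iw≡length-IncSufUpTo c p with reverse p
... | [] = refl
... | x ∷ _ with x ≤? c
...   | yes _ = refl
...   | no _ = refl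

IncSufUpTo-∷ʳ-≤ : ∀ {c x} q → x ≤ c → IncSufUpTo c (q ∷ʳ x) ≡ reverse (dp x (reverse q))
IncSufUpTo-∷ʳ-≤ {c} {x} q x≤c rewrite LP.reverse-++ q (x ∷ []) with x ≤? c
... | yes _ = IncSuf-∷ʳ q x
... | no x≰c = ⊥-elim (x≰c x≤c)

IncSufUpTo-∷ʳ-≰ : ∀ {c x} q → ¬ x ≤ c → IncSufUpTo c (q ∷ʳ x) ≡ []
IncSufUpTo-∷ʳ-≰ {c} {x} q x≰c rewrite LP.reverse-++ q (x ∷ []) with x ≤? c
... | yes x≤c = ⊥-elim (x≰c x≤c)
... | no _ = refl

∈-IncSufUpTo⁺ : ∀ {c x j} q → x ≤ c → j ∈ IncSuf (q ∷ʳ x) → j ∈ IncSufUpTo c (q ∷ʳ x)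
∈-IncSufUpTo⁺ q x≤c j∈ = subst (_ ∈_) (sym (trans (IncSufUpTo-∷ʳ-≤ q x≤c) (sym (IncSuf-∷ʳ q _)))) j∈

∈-IncSufUpTo⁻ : ∀ {c j} p → j ∈ IncSufUpTo c p →
  Σ (List ℤ) λ q → Σ ℤ λ x → p ≡ q ∷ʳ x × x ≤ c × j ∈ IncSuf p
∈-IncSufUpTo⁻ {c} {j} p j∈ with reverseView p
... | q ∶ _ ∶ʳ x with x ≤? c
...   | yes x≤c = q , x , refl , x≤c , subst (j ∈_) (trans (IncSufUpTo-∷ʳ-≤ q x≤c) (sym (IncSuf-∷ʳ q x))) j∈
...   | no x≰c with () ← subst (j ∈_) (IncSufUpTo-∷ʳ-≰ q x≰c) j∈

IncSufUpTo-unique : ∀ c p → Unique (IncSufUpTo c p)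
IncSufUpTo-unique c p with reverseView p
... | [] = []
... | q ∶ _ ∶ʳ x with x ≤? c
...   | yes x≤c = subst Unique (trans (IncSuf-∷ʳ q x) (sym (IncSufUpTo-∷ʳ-≤ q x≤c))) (IncSuf-unique (q ∷ʳ x))
...   | no x≰c = subst Unique (sym (IncSufUpTo-∷ʳ-≰ q x≰c)) []

IncSufUpTo-mono : ∀ {c d j} p → c ≤ d → j ∈ IncSufUpTo c p → j ∈ IncSufUpTo d p
IncSufUpTo-mono p c≤d j∈ with ∈-IncSufUpTo⁻ p j∈
... | q , x , refl , x≤c , j∈′ = ∈-IncSufUpTo⁺ q (ℤP.≤-trans x≤c c≤d) j∈′

IncSufUpTo-∷ʳ : ∀ {a j} q → j ∈ IncSufUpTo (a - 1ℤ) q → j ∈ IncSuf (q ∷ʳ a)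
IncSufUpTo-∷ʳ q j∈ with ∈-IncSufUpTo⁻ q j∈
... | q′ , y , refl , y≤a-1 , j∈′ = subst (_ ∈_) (sym (IncSuf-∷ʳ-∷ʳ q′ (i≤j-1⇒i<j y≤a-1))) (∈P.∈-++⁺ˡ j∈′)

Iw-mono : ∀ {c d} p → c ≤ d → Iw c p ≤ℕ Iw d p
Iw-mono {c} {d} p c≤d = subst₂ _≤ℕ_ (sym (Iw≡length-IncSufUpTo c p)) (sym (Iw≡length-IncSufUpTo d p))
  (unique-length-≤ (IncSufUpTo-unique c p) (IncSufUpTo-mono p c≤d))

-- Increasing suffixes of reduced words

IncSuf-θ : ∀ {M f} → Confined M f → ∀ p → IsReducedWordFor f p → ∀ j → j ∈ IncSuf p → θ f j
IncSuf-θ {f = f} conf p reduced j j∈ with IncSuf-split p j∈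
... | u , v , refl , j<v = evalWord (reverse v) (j + 1ℤ) , j<j′ , subst₂ _<_ (sym fj′≡) (sym fj≡) descent
  where
  h : ℤ → ℤ
  h = evalWord (u ∷ʳ j)
  descent : h (j + 1ℤ) < h j
  descent = reduced⇒last-descent u
    (confined-∘evalWord (u ∷ʳ j) (letters-within (u ∷ʳ j) ℕP.≤-refl) (confined-id _))
    (reduced-prefix (u ∷ʳ j) v reduced)
  j<j′ : j < evalWord (reverse v) (j + 1ℤ)
  j<j′ = evalWord-preserves-> (reverse v) (All-reverse j<v) (i<i+1 j)
  f≡h∘v : ∀ x → f x ≡ h (evalWord v x)
  f≡h∘v x = trans (sym (proj₁ reduced x)) (evalWord-++ (u ∷ʳ j) v x)
  fj′≡ : f (evalWord (reverse v) (j + 1ℤ)) ≡ h (j + 1ℤ)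
  fj′≡ = trans (f≡h∘v _) (cong h (evalWord-reverse v (j + 1ℤ)))
  fj≡ : f j ≡ h j
  fj≡ = trans (f≡h∘v j) (cong h (evalWord-fix-≤ v j<v ℤP.≤-refl))

module _ {M f} (conf : Confined M f) (i : ℤ) where

  θ-upTo? : ∀ j → Dec (j ≤ i × θ f j)
  θ-upTo? j = (j ≤? i) ×-dec θ? conf j

  Λ : List ℤ
  Λ = filter θ-upTo? (window M)

  Λ-unique : Unique Λ
  Λ-unique = UniqueP.filter⁺ θ-upTo? (window-unique M)

  ∈-Λ⁻ : ∀ {j} → j ∈ Λ → j ≤ i × θ f j
  ∈-Λ⁻ j∈Λ = proj₂ (∈P.∈-filter⁻ θ-upTo? {xs = window M} j∈Λ)

  ∈-Λ⁺ : ∀ {j} → j ≤ i × θ f j → j ∈ Λ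
  ∈-Λ⁺ j≤i,θj = ∈P.∈-filter⁺ θ-upTo? (∈-window⁺ M (θ-in-window conf (proj₂ j≤i,θj))) j≤i,θj

  Iw≤length-Λ : ∀ p → IsReducedWordFor f p → Iw i p ≤ℕ length Λ
  Iw≤length-Λ p reduced = subst (_≤ℕ length Λ) (sym (Iw≡length-IncSufUpTo i p))
    (unique-length-≤ (IncSufUpTo-unique i p) (λ j∈ → ∈-Λ⁺ (collected j∈)))
    where
    collected : ∀ {j} → j ∈ IncSufUpTo i p → j ≤ i × θ f j
    collected {j} j∈ with ∈-IncSufUpTo⁻ p j∈
    ... | q , x , refl , x≤i , j∈′ = ℤP.≤-trans (IncSuf-≤-last q x j∈′) x≤i , IncSuf-θ conf p reduced j j∈′

  largest-θ : (∀ j → j ≤ i → ¬ θ f j) ⊎ Σ ℤ λ a → (a ≤ i × θ f a) × (∀ j → j ≤ i → θ f j → j ≤ a)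
  largest-θ = go Λ ∈-Λ⁻ ∈-Λ⁺
    where
    go : ∀ L → (∀ {j} → j ∈ L → j ≤ i × θ f j) → (∀ {j} → j ≤ i × θ f j → j ∈ L) →
         (∀ j → j ≤ i → ¬ θ f j) ⊎ Σ ℤ λ a → (a ≤ i × θ f a) × (∀ j → j ≤ i → θ f j → j ≤ a)
    go [] _ complete = inj₁ (λ j j≤i θj → case complete (j≤i , θj) of λ ())
    go (x ∷ L) sound complete = inj₂ (max x L , sound max∈ , λ j j≤i θj → ≤max (complete (j≤i , θj)))
      where
      max∈ : max x L ∈ x ∷ L
      max∈ = argmax-all (λ y → y) (here refl) (All.tabulate there)
      ≤max : ∀ {y} → y ∈ x ∷ L → y ≤ max x L
      ≤max (here refl) = ⊥≤max x L
      ≤max (there y∈L) = All.lookup (xs≤max x L) y∈L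

after-largest-θ : ∀ {f i a} → ¬ θ f i → a ≤ i → θ f a → (∀ j → j ≤ i → θ f j → j ≤ a) → a < i × ¬ θ f (a + 1ℤ)
after-largest-θ {i = i} {a} ¬θi a≤i θa largest =
    a<i
  , λ θa+1 → ℤP.<⇒≱ (i<i+1 _) (largest _ (i<j⇒i+1≤j a<i) θa+1)
  where
  a<i : a < i
  a<i = ℤP.≤∧≢⇒< a≤i (λ { refl → ¬θi θa })

Collects : (ℤ → ℤ) → ℤ → List ℤ → Set
Collects f i p = ∀ j → j ≤ i → θ f j → j ∈ IncSufUpTo (i - 1ℤ) p

collects-∷ʳ : ∀ {f a i} p → a < i → (∀ j → j ≤ i → θ f j → j ≤ a) →
              Collects (f ∘ s a) a p → Collects f i (p ∷ʳ a)
collects-∷ʳ {f} {a} p a<i largest collects j j≤i θj with ℤP.<-cmp j a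
... | tri< j<a _ _ =
  ∈-IncSufUpTo⁺ p (i<j⇒i≤j-1 a<i) (IncSufUpTo-∷ʳ p (collects j (ℤP.<⇒≤ j<a) (θ-∘s-below j<a θj)))
... | tri≈ _ refl _ = ∈-IncSufUpTo⁺ p (i<j⇒i≤j-1 a<i) (last-∈-IncSuf p a)
... | tri> _ _ a<j = ⊥-elim (ℤP.<⇒≱ a<j (largest j j≤i θj))

reduced-collecting-θ : ∀ n {M f} → Confined M f → inversions M f ≡ n → ∀ i → ¬ θ f i →
                       Σ (List ℤ) λ p → IsReducedWordFor f p × Collects f i p
reduced-collecting-θ-∷ʳ : ∀ n {M f a i} → Confined M f → inversions M f ≡ n → a < i → θ f a → ¬ θ f (a + 1ℤ) →
                          (∀ j → j ≤ i → θ f j → j ≤ a) → Σ (List ℤ) λ p → IsReducedWordFor f p × Collects f i p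

reduced-collecting-θ n conf inv≡n i ¬θi with largest-θ conf i
... | inj₁ none = let p , reduced = reduced-exists conf in p , reduced , λ j j≤i θj → ⊥-elim (none j j≤i θj)
... | inj₂ (a , (a≤i , θa) , largest) =
  let a<i , ¬θa+1 = after-largest-θ ¬θi a≤i θa largest
  in reduced-collecting-θ-∷ʳ n conf inv≡n a<i θa ¬θa+1 largest

reduced-collecting-θ-∷ʳ zero conf inv≡0 a<i θa ¬θa+1 largest =
  ⊥-elim (ℕP.1+n≢0 (trans (proj₂ (descent-step conf (θ-in-window conf θa) (θ-descent θa ¬θa+1))) inv≡0))
reduced-collecting-θ-∷ʳ (suc n) {M} {f} {a} conf inv≡1+n a<i θa ¬θa+1 largest =
  let conf′ , 1+inv′≡inv = descent-step conf ∣a∣≤M desc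
      p , reduced , collects =
        reduced-collecting-θ n conf′ (ℕP.suc-injective (trans 1+inv′≡inv inv≡1+n)) a (θ-∘s-self desc ¬θa+1)
  in p ∷ʳ a , reduced-∷ʳ p conf ∣a∣≤M desc reduced , collects-∷ʳ p a<i largest collects
  where
  desc : f (a + 1ℤ) < f a
  desc = θ-descent θa ¬θa+1
  ∣a∣≤M : ∣ a ∣ ≤ℕ M
  ∣a∣≤M = θ-in-window conf θa

IsMaxIw : (ℤ → ℤ) → ℤ → ℕ → Set
IsMaxIw f c m =
  Σ (List ℤ) (λ p → IsReducedWordFor f p × Iw c p ≡ m) × (∀ p → IsReducedWordFor f p → Iw c p ≤ℕ m)

Iw-max : ∀ {M f i} (conf : Confined M f) → ¬ θ f i → ∀ c → i - 1ℤ ≤ c → c ≤ i → IsMaxIw f c (length (Λ conf i))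
Iw-max {i = i} conf ¬θi c i-1≤c c≤i with reduced-collecting-θ _ conf refl i ¬θi
... | p , reduced , collects =
  (p , reduced , ℕP.≤-antisym (bounded p reduced) (ℕP.≤-trans length-Λ≤Iw (Iw-mono p i-1≤c))) , bounded
  where
  bounded : ∀ q → IsReducedWordFor _ q → Iw c q ≤ℕ length (Λ conf i)
  bounded q reduced′ = ℕP.≤-trans (Iw-mono q c≤i) (Iw≤length-Λ conf i q reduced′)
  length-Λ≤Iw : length (Λ conf i) ≤ℕ Iw (i - 1ℤ) p
  length-Λ≤Iw = subst (length (Λ conf i) ≤ℕ_) (sym (Iw≡length-IncSufUpTo (i - 1ℤ) p))
    (unique-length-≤ (Λ-unique conf i) (λ j∈ → collects _ (proj₁ (∈-Λ⁻ conf i j∈)) (proj₂ (∈-Λ⁻ conf i j∈))))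

confined-SZ : (w : SZ) → Confined (proj₁ (finSupp w)) (fun w)
confined-SZ w = record
  { fixes-outside = λ {x} → proj₂ (finSupp w) x
  ; injective     = λ {x} {y} wx≡wy → trans (sym (inv-l w x)) (trans (cong (inv w) wx≡wy) (inv-l w y))
  }

proposition5p11 : (w : SZ) →
    (∀ (p : List ℤ) → IsReducedWord w p → ∀ j → j ∈ IncSuf p → θ-one w j)
    × (∀ (i : ℤ) → Σ ℕ (λ n → LambdaIs w i n
        × (∀ (p : List ℤ) → IsReducedWord w p → Iw i p ≤ℕ n)))
    × (∀ (i : ℤ) → ¬ θ-one w i → Σ ℕ (λ n → LambdaIs w i n
        × IMaxIs w (i - 1ℤ) n × IMaxIs w i n))
proposition5p11 w =
    IncSuf-θ conf
  , (λ i → length (Λ conf i) , lambda i , Iw≤length-Λ conf i)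
  , (λ i ¬θi → length (Λ conf i) , lambda i
             , Iw-max conf ¬θi (i - 1ℤ) ℤP.≤-refl (ℤP.i-j≤i i 1ℤ)
             , Iw-max conf ¬θi i (ℤP.i-j≤i i 1ℤ) ℤP.≤-refl)
  where
  conf : Confined (proj₁ (finSupp w)) (fun w)
  conf = confined-SZ w
  lambda : ∀ i → LambdaIs w i (length (Λ conf i))
  lambda i = Λ conf i , Λ-unique conf i , (λ j → mk⇔ (∈-Λ⁻ conf i) (∈-Λ⁺ conf i)) , refl
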